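{- Let $n\ge 3$ and $3\le k\le 2^n-1$ be integers. Then $\operatorname{Ind}_2(n,k,3)=2^{n-1}$ if $k=3$, and $\operatorname{Ind}_2(n,k,3)=2^n-1$ if $k\ge 4$.
   Context: For $1\le\ell\le k\le q^n-1$ with $\ell\le n$, a set $S\subseteq\mathbb{F}_q^n\setminus\{\mathbf 0\}$ is $(k,\ell)$-independent if every subset of $S$ of size $k$ contains $\ell$ linearly independent vectors; $\operatorname{Ind}_q(n,k,\ell)$ is the maximum size of a $(k,\ell)$-independent subset of $\mathbb{F}_q^n\setminus\{\mathbf 0\}$. Here $q=2$. -}

module Defs where

open import Data.Bool using (Bool; true; false; _∧_; _xor_)
open import Data.Nat using (ℕ; zero; suc; _≤_)
open import Data.Fin using (Fin)
import Data.Fin as F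
open import Data.Vec using (Vec; replicate; zipWith; map)
open import Data.List using (List; length)
open import Data.List.Membership.Propositional using (_∈_)
open import Data.List.Relation.Unary.All using (All)
open import Data.List.Relation.Unary.Unique.Propositional using (Unique)
open import Data.List.Relation.Binary.Sublist.Propositional using (_⊆_)
open import Data.Product using (Σ; _×_; ∃)
open import Relation.Binary.PropositionalEquality using (_≡_)
open import Relation.Nullary using (¬_)

-- Vectors of F_2^n, with F_2 = Bool (addition = xor, multiplication = ∧).
V : ℕ → Set
V n = Vec Bool n

𝟎 : ∀ {n} → V n
𝟎 {n} = replicate n false

_⊕_ : ∀ {n} → V n → V n → V n
_⊕_ = zipWith _xor_

_·_ : ∀ {n} → Bool → V n → V n
c · v = map (c ∧_) v

lincomb : ∀ {n ℓ} → (Fin ℓ → Bool) → (Fin ℓ → V n) → V n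
lincomb {ℓ = zero}  c v = 𝟎
lincomb {ℓ = suc ℓ} c v = (c F.zero · v F.zero) ⊕ lincomb (λ i → c (F.suc i)) (λ i → v (F.suc i))

LinIndep : ∀ {n ℓ} → (Fin ℓ → V n) → Set
LinIndep {ℓ = ℓ} v = ∀ (c : Fin ℓ → Bool) → lincomb c v ≡ 𝟎 → ∀ i → c i ≡ false

HasIndep : ∀ {n} → ℕ → List (V n) → Set
HasIndep {n} ℓ T = Σ (Fin ℓ → V n) λ v → (∀ i → v i ∈ T) × LinIndep v

-- S is a subset of F_2^n \ {0}: a duplicate-free list of nonzero vectors.
IsNonzeroSet : ∀ {n} → List (V n) → Set
IsNonzeroSet S = Unique S × All (λ v → ¬ (v ≡ 𝟎)) S

KLIndependent : ∀ {n} → ℕ → ℕ → List (V n) → Set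
KLIndependent k ℓ S = ∀ (T : List _) → T ⊆ S → length T ≡ k → HasIndep ℓ T

-- Ind_2(n,k,ℓ) = m : m is the maximum size of a (k,ℓ)-independent subset of F_2^n \ {0}.
IndEq : ℕ → ℕ → ℕ → ℕ → Set
IndEq n k ℓ m =
  (Σ (List (V n)) λ S → IsNonzeroSet S × KLIndependent k ℓ S × length S ≡ m)
  × (∀ (S : List (V n)) → IsNonzeroSet S → KLIndependent k ℓ S → length S ≤ m)

-- A family of ℓ independent vectors lying in the span of m vectors has ℓ ≤ m: its 2^ℓ linear
-- combinations are distinct and occur among the 2^m combinations of the spanning family.
-- So a (3,3)-independent S contains no triple a, t, a ⊕ t (it would put three points of S into a
-- 2-dimensional span); for a ∈ S this makes S and a ⊕ S disjoint, whence 2 |S| ≤ 2ⁿ. The 2ⁿ⁻¹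
-- vectors with first coordinate 1 attain the bound, as the sum of two of them has first
-- coordinate 0. For k ≥ 4 all nonzero vectors work: among four distinct nonzero a, b, c, d, one
-- of c, d differs from a ⊕ b, and three distinct nonzero vectors none of which is the sum of the
-- other two are independent.
module Submission where

open import Defs
open import Data.Nat using (ℕ; _≤_; _^_; _∸_)
open import Data.Product using (_×_)
open import Relation.Binary.PropositionalEquality using (_≡_)

open import Algebra.Bundles using (AbelianGroup; CommutativeRing)
import Algebra.Lattice.Properties.BooleanAlgebra as BooleanAlgebraProperties
import Algebra.Properties.AbelianGroup as AbelianGroupProperties
import Algebra.Properties.CommutativeSemigroup as CommutativeSemigroupProperties
open import Data.Bool using (Bool; true; false; _xor_)
import Data.Bool as Bool
open import Data.Bool.Properties using (xor-is-ok; ∧-distribʳ-xor; xor-∧-commutativeRing)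
open import Data.Empty using (⊥; ⊥-elim)
open import Data.Fin using (Fin; zero; suc; _≟_)
import Data.Fin.Properties as Fin
open import Data.Fin.Subset using (_∪_; _∩_; ∁)
open import Data.Fin.Subset.Properties using (∪-∩-booleanAlgebra)
open import Data.List using (List; []; _∷_; _++_; length)
import Data.List as List
import Data.List.Properties as List
open import Data.List.Membership.Propositional using (_∈_; _∉_)
open import Data.List.Membership.Propositional.Properties
  using (∈-map⁺; ∈-map⁻; ∈-++⁺ˡ; ∈-++⁺ʳ; ∈-lookup; ∈-filter⁺)
import Data.List.Relation.Binary.Subset.Propositional as Subset
open import Data.List.Relation.Binary.Sublist.Propositional
  using (_⊆_; []; _∷_; _∷ʳ_; ⊆-refl; ⊆-trans; minimum)
open import Data.List.Relation.Binary.Sublist.Propositional.Properties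
  using (All-resp-⊆; Any-resp-⊆; take-⊆; filter-⊆)
open import Data.List.Relation.Unary.All using (All; []; _∷_)
import Data.List.Relation.Unary.All as All
import Data.List.Relation.Unary.All.Properties as All
open import Data.List.Relation.Unary.AllPairs using ([]; _∷_)
open import Data.List.Relation.Unary.Any using (here; there)
import Data.List.Relation.Unary.Any as Any
open import Data.List.Relation.Unary.Any.Properties using (lookup-index)
open import Data.List.Relation.Unary.Unique.Propositional using (Unique)
import Data.List.Relation.Unary.Unique.Propositional.Properties as Unique
open import Data.Nat using (zero; suc; _+_; _*_; _<_; z≤n; s≤s)
import Data.Nat.Properties as ℕ
open import Data.Product using (∃; _,_)
open import Data.Sum using (_⊎_; inj₁; inj₂; [_,_]′)
open import Data.Vec using ([]; _∷_; tabulate)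
import Data.Vec as Vec
import Data.Vec.Properties as Vec
open import Data.Vec.Relation.Binary.Pointwise.Extensional using (ext; Pointwise-≡⇒≡)
open import Function using (_∘_)
open import Level using (0ℓ)
open import Relation.Binary using (DecidableEquality)
open import Relation.Binary.PropositionalEquality
  using (_≢_; refl; sym; trans; cong; cong₂; subst; subst₂; module ≡-Reasoning)
open import Relation.Nullary using (Dec; does; yes; no; ¬?)

private
  variable
    n m k ℓ : ℕ

-- Fⁿ₂ as a Boolean group

⊕-def : (x y : V n) → x ⊕ y ≡ (x ∪ y) ∩ ∁ (x ∩ y)
⊕-def []      []      = refl
⊕-def (a ∷ x) (b ∷ y) = cong₂ _∷_ (xor-is-ok a b) (⊕-def x y)

-- V n is the Boolean algebra Subset n, and _⊕_ its symmetric difference.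
⊕-abelianGroup : ℕ → AbelianGroup 0ℓ 0ℓ
⊕-abelianGroup n = CommutativeRing.+-abelianGroup (XorRing.⊕-∧-commutativeRing _⊕_ ⊕-def)
  where open BooleanAlgebraProperties (∪-∩-booleanAlgebra n) using (module XorRing)

module ⊕-Group {n : ℕ} where
  open AbelianGroup (⊕-abelianGroup n) public
    using (comm; identityˡ; identityʳ; inverseˡ; commutativeSemigroup)
  open AbelianGroupProperties (⊕-abelianGroup n) public
    using (inverseˡ-unique; \\-leftDividesˡ)
  open CommutativeSemigroupProperties commutativeSemigroup public
    using (interchange)

open ⊕-Group

⊕-self : (x : V n) → x ⊕ x ≡ 𝟎
⊕-self = inverseˡ

⊕≡𝟎⇒≡ : {x y : V n} → x ⊕ y ≡ 𝟎 → x ≡ y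
⊕≡𝟎⇒≡ = inverseˡ-unique _ _

⊕≢𝟎 : {x y : V n} → x ≢ y → x ⊕ y ≢ 𝟎
⊕≢𝟎 x≢y = x≢y ∘ ⊕≡𝟎⇒≡

x⊕[x⊕y]≡y : (x y : V n) → x ⊕ (x ⊕ y) ≡ y
x⊕[x⊕y]≡y = \\-leftDividesˡ

⊕-cancelˡ : (a : V n) {x y : V n} → a ⊕ x ≡ a ⊕ y → x ≡ y
⊕-cancelˡ a {x} {y} eq = trans (sym (x⊕[x⊕y]≡y a x)) (trans (cong (a ⊕_) eq) (x⊕[x⊕y]≡y a y))

x≡x⊕y⇒y≡𝟎 : {x y : V n} → x ≡ x ⊕ y → y ≡ 𝟎
x≡x⊕y⇒y≡𝟎 {x = x} eq = ⊕-cancelˡ x (trans (sym eq) (sym (identityʳ x)))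

xor≡false⇒≡ : {a b : Bool} → a xor b ≡ false → a ≡ b
xor≡false⇒≡ = XorGroup.inverseˡ-unique _ _
  where module XorGroup = AbelianGroupProperties (CommutativeRing.+-abelianGroup xor-∧-commutativeRing)

_≟ᵥ_ : DecidableEquality (V n)
_≟ᵥ_ = Vec.≡-dec Bool._≟_

_∈?_ : (x : V n) (xs : List (V n)) → Dec (x ∈ xs)
x ∈? xs = Any.any? (x ≟ᵥ_) xs

-- Linear combinations

true-· : (x : V n) → true · x ≡ x
true-· = Vec.map-id

false-· : (x : V n) → false · x ≡ 𝟎
false-· x = Vec.map-const x false

false-·-⊕ : (x y : V n) → (false · x) ⊕ y ≡ y
false-·-⊕ x y = trans (cong (_⊕ y) (false-· x)) (identityˡ y)

·-distribʳ-xor : (a b : Bool) (x : V n) → (a · x) ⊕ (b · x) ≡ (a xor b) · x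
·-distribʳ-xor a b []       = refl
·-distribʳ-xor a b (x ∷ xs) = cong₂ _∷_ (sym (∧-distribʳ-xor x a b)) (·-distribʳ-xor a b xs)

lincomb-cong : {c d : Fin ℓ → Bool} (u : Fin ℓ → V n) → (∀ i → c i ≡ d i) → lincomb c u ≡ lincomb d u
lincomb-cong {ℓ = zero}  u c≗d = refl
lincomb-cong {ℓ = suc ℓ} u c≗d =
  cong₂ _⊕_ (cong (_· u zero) (c≗d zero)) (lincomb-cong (u ∘ suc) (c≗d ∘ suc))

lincomb-false : (u : Fin ℓ → V n) → lincomb (λ _ → false) u ≡ 𝟎
lincomb-false {ℓ = zero}  u = refl
lincomb-false {ℓ = suc ℓ} u = trans (false-·-⊕ (u zero) _) (lincomb-false (u ∘ suc))

lincomb-xor : (c d : Fin ℓ → Bool) (u : Fin ℓ → V n) →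
              lincomb c u ⊕ lincomb d u ≡ lincomb (λ i → c i xor d i) u
lincomb-xor {ℓ = zero}  c d u = identityˡ 𝟎
lincomb-xor {ℓ = suc ℓ} c d u = begin
  ((c zero · u zero) ⊕ lincomb (c ∘ suc) (u ∘ suc)) ⊕ ((d zero · u zero) ⊕ lincomb (d ∘ suc) (u ∘ suc))
    ≡⟨ interchange _ _ _ _ ⟩
  ((c zero · u zero) ⊕ (d zero · u zero)) ⊕ (lincomb (c ∘ suc) (u ∘ suc) ⊕ lincomb (d ∘ suc) (u ∘ suc))
    ≡⟨ cong₂ _⊕_ (·-distribʳ-xor (c zero) (d zero) (u zero)) (lincomb-xor (c ∘ suc) (d ∘ suc) (u ∘ suc)) ⟩
  ((c zero xor d zero) · u zero) ⊕ lincomb (λ i → c (suc i) xor d (suc i)) (u ∘ suc)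
    ∎
  where open ≡-Reasoning

lincomb-indicator : (u : Fin ℓ → V n) (i : Fin ℓ) → lincomb (λ j → does (j ≟ i)) u ≡ u i
lincomb-indicator u zero    =
  trans (cong₂ _⊕_ (true-· (u zero)) (lincomb-false (u ∘ suc))) (identityʳ (u zero))
lincomb-indicator u (suc i) = trans (false-·-⊕ (u zero) _) (lincomb-indicator (u ∘ suc) i)

-- Counting duplicate-free lists

unique⇒lookup-injective : {A : Set} {xs : List A} → Unique xs →
                          ∀ i j → List.lookup xs i ≡ List.lookup xs j → i ≡ j
unique⇒lookup-injective (_    ∷ _)    zero    zero    _  = refl
unique⇒lookup-injective (x≢xs ∷ _)    zero    (suc j) eq = ⊥-elim (All.lookup x≢xs (∈-lookup j) eq)
unique⇒lookup-injective (x≢xs ∷ _)    (suc i) zero    eq = ⊥-elim (All.lookup x≢xs (∈-lookup i) (sym eq))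
unique⇒lookup-injective (_    ∷ uniq) (suc i) (suc j) eq = cong suc (unique⇒lookup-injective uniq i j eq)

Unique⇒length≤ : {A : Set} {xs ys : List A} → Unique xs → xs Subset.⊆ ys → length xs ≤ length ys
Unique⇒length≤ {xs = xs} {ys} uniq xs⊆ys = Fin.injective⇒≤ position-injective
  where
  position : Fin (length xs) → Fin (length ys)
  position i = Any.index (xs⊆ys (∈-lookup i))

  position-injective : ∀ {i j} → position i ≡ position j → i ≡ j
  position-injective {i} {j} eq = unique⇒lookup-injective uniq i j (begin
    List.lookup xs i             ≡⟨ lookup-index (xs⊆ys (∈-lookup i)) ⟩
    List.lookup ys (position i)  ≡⟨ cong (List.lookup ys) eq ⟩
    List.lookup ys (position j)  ≡⟨ lookup-index (xs⊆ys (∈-lookup j)) ⟨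
    List.lookup xs j             ∎)
    where open ≡-Reasoning

Unique-resp-⊆ : {A : Set} {xs ys : List A} → xs ⊆ ys → Unique ys → Unique xs
Unique-resp-⊆ []             []            = []
Unique-resp-⊆ (_ ∷ʳ xs⊆ys)   (_ ∷ uniq)    = Unique-resp-⊆ xs⊆ys uniq
Unique-resp-⊆ (refl ∷ xs⊆ys) (y∉ys ∷ uniq) = All-resp-⊆ xs⊆ys y∉ys ∷ Unique-resp-⊆ xs⊆ys uniq

IsNonzeroSet-resp-⊆ : {S T : List (V n)} → T ⊆ S → IsNonzeroSet S → IsNonzeroSet T
IsNonzeroSet-resp-⊆ T⊆S (uniq , nonzero) = Unique-resp-⊆ T⊆S uniq , All-resp-⊆ T⊆S nonzero

allVec : ∀ n → List (V n)
allVec zero    = [] ∷ []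
allVec (suc n) = List.map (false ∷_) (allVec n) ++ List.map (true ∷_) (allVec n)

∈-allVec : (x : V n) → x ∈ allVec n
∈-allVec []          = here refl
∈-allVec (false ∷ x) = ∈-++⁺ˡ (∈-map⁺ (false ∷_) (∈-allVec x))
∈-allVec (true ∷ x)  = ∈-++⁺ʳ _ (∈-map⁺ (true ∷_) (∈-allVec x))

allVec-unique : ∀ n → Unique (allVec n)
allVec-unique zero    = [] ∷ []
allVec-unique (suc n) =
  Unique.++⁺ (Unique.map⁺ Vec.∷-injectiveʳ (allVec-unique n)) (Unique.map⁺ Vec.∷-injectiveʳ (allVec-unique n))
             (λ (x∈false∷ , x∈true∷) → heads-differ x∈false∷ x∈true∷)
  where
  heads-differ : {x : V (suc n)} → x ∈ List.map (false ∷_) (allVec n) → x ∈ List.map (true ∷_) (allVec n) → ⊥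
  heads-differ x∈false∷ x∈true∷ with ∈-map⁻ _ x∈false∷ | ∈-map⁻ _ x∈true∷
  ... | _ , _ , refl | _ , _ , ()

length-allVec : ∀ n → length (allVec n) ≡ 2 ^ n
length-allVec zero    = refl
length-allVec (suc n) = begin
  length (List.map (false ∷_) (allVec n) ++ List.map (true ∷_) (allVec n))
    ≡⟨ List.length-++ (List.map (false ∷_) (allVec n)) ⟩
  length (List.map (false ∷_) (allVec n)) + length (List.map (true ∷_) (allVec n))
    ≡⟨ cong₂ _+_ (List.length-map _ (allVec n)) (List.length-map _ (allVec n)) ⟩
  length (allVec n) + length (allVec n)
    ≡⟨ cong₂ _+_ (length-allVec n) (length-allVec n) ⟩
  2 ^ n + 2 ^ n
    ≡⟨ cong (2 ^ n +_) (ℕ.+-identityʳ (2 ^ n)) ⟨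
  2 ^ suc n
    ∎
  where open ≡-Reasoning

-- Spans and the dimension bound

-- The 2^m combinations of u, indexed by coefficient vectors; repetitions occur unless u is independent.
span : (Fin m → V n) → List (V n)
span {m} u = List.map (λ d → lincomb (Vec.lookup d) u) (allVec m)

length-span : (u : Fin m → V n) → length (span u) ≡ 2 ^ m
length-span {m} u = trans (List.length-map _ (allVec m)) (length-allVec m)

lincomb∈span : (u : Fin m → V n) (c : Fin m → Bool) → lincomb c u ∈ span u
lincomb∈span u c =
  subst (_∈ span u) (lincomb-cong u (Vec.lookup∘tabulate c)) (∈-map⁺ _ (∈-allVec (tabulate c)))

∈span⇒lincomb : {u : Fin m → V n} {x : V n} → x ∈ span u → ∃ λ c → lincomb c u ≡ x
∈span⇒lincomb x∈span with d , _ , x≡ ← ∈-map⁻ _ x∈span = Vec.lookup d , sym x≡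

𝟎∈span : (u : Fin m → V n) → 𝟎 ∈ span u
𝟎∈span u = subst (_∈ span u) (lincomb-false u) (lincomb∈span u _)

generator∈span : (u : Fin m → V n) (i : Fin m) → u i ∈ span u
generator∈span u i = subst (_∈ span u) (lincomb-indicator u i) (lincomb∈span u _)

∈span-⊕ : {u : Fin m → V n} {x y : V n} → x ∈ span u → y ∈ span u → x ⊕ y ∈ span u
∈span-⊕ {u = u} x∈span y∈span
  with c , refl ← ∈span⇒lincomb x∈span | d , refl ← ∈span⇒lincomb y∈span =
  subst (_∈ span u) (sym (lincomb-xor c d u)) (lincomb∈span u _)

∈span-· : {u : Fin m → V n} {x : V n} (b : Bool) → x ∈ span u → b · x ∈ span u
∈span-· {u = u} true  x∈span = subst (_∈ span u) (sym (true-· _)) x∈span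
∈span-· {u = u} false _      = subst (_∈ span u) (sym (false-· _)) (𝟎∈span u)

lincomb∈span-of : {u : Fin m → V n} {v : Fin ℓ → V n} → (∀ i → v i ∈ span u) →
                  (c : Fin ℓ → Bool) → lincomb c v ∈ span u
lincomb∈span-of {ℓ = zero}  _      _ = 𝟎∈span _
lincomb∈span-of {ℓ = suc ℓ} v∈span c =
  ∈span-⊕ (∈span-· (c zero) (v∈span zero)) (lincomb∈span-of (v∈span ∘ suc) (c ∘ suc))

span-⊆ : {u : Fin m → V n} {v : Fin ℓ → V n} → (∀ i → v i ∈ span u) → span v Subset.⊆ span u
span-⊆ v∈span x∈span with c , refl ← ∈span⇒lincomb x∈span = lincomb∈span-of v∈span c

span-unique : {u : Fin m → V n} → LinIndep u → Unique (span u)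
span-unique {m} {u = u} indep = Unique.map⁺ lincomb-injective (allVec-unique m)
  where
  lincomb-injective : ∀ {d d′} → lincomb (Vec.lookup d) u ≡ lincomb (Vec.lookup d′) u → d ≡ d′
  lincomb-injective {d} {d′} eq = Pointwise-≡⇒≡ (ext λ j → xor≡false⇒≡ (indep _ difference≡𝟎 j))
    where
    difference≡𝟎 : lincomb (λ j → Vec.lookup d j xor Vec.lookup d′ j) u ≡ 𝟎
    difference≡𝟎 = begin
      lincomb (λ j → Vec.lookup d j xor Vec.lookup d′ j) u   ≡⟨ lincomb-xor (Vec.lookup d) (Vec.lookup d′) u ⟨
      lincomb (Vec.lookup d) u ⊕ lincomb (Vec.lookup d′) u   ≡⟨ cong (_⊕ lincomb (Vec.lookup d′) u) eq ⟩
      lincomb (Vec.lookup d′) u ⊕ lincomb (Vec.lookup d′) u  ≡⟨ ⊕-self _ ⟩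
      𝟎                                                     ∎
      where open ≡-Reasoning

linIndep-in-span⇒≤ : {u : Fin m → V n} {v : Fin ℓ → V n} → (∀ i → v i ∈ span u) → LinIndep v → ℓ ≤ m
linIndep-in-span⇒≤ {m = m} {ℓ = ℓ} {u = u} {v} v∈span indep =
  ℕ.≮⇒≥ λ m<ℓ → ℕ.<⇒≱ (ℕ.^-monoʳ-< 2 (ℕ.n<1+n 1) m<ℓ) 2^ℓ≤2^m
  where
  2^ℓ≤2^m : 2 ^ ℓ ≤ 2 ^ m
  2^ℓ≤2^m = subst₂ _≤_ (length-span v) (length-span u) (Unique⇒length≤ (span-unique indep) (span-⊆ v∈span))

-- Independence of three vectors

∈span-∷⁻ : {u : Fin (suc m) → V n} {x : V n} → x ∈ span u →
           x ∈ span (u ∘ suc) ⊎ u zero ⊕ x ∈ span (u ∘ suc)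
∈span-∷⁻ {u = u} x∈span with c , refl ← ∈span⇒lincomb {u = u} x∈span =
  by-head-coefficient (c zero) (lincomb∈span (u ∘ suc) (c ∘ suc))
  where
  by-head-coefficient : ∀ {y} b → y ∈ span (u ∘ suc) →
                        (b · u zero) ⊕ y ∈ span (u ∘ suc) ⊎ u zero ⊕ ((b · u zero) ⊕ y) ∈ span (u ∘ suc)
  by-head-coefficient {y} false y∈span = inj₁ (subst (_∈ span (u ∘ suc)) (sym (false-·-⊕ (u zero) y)) y∈span)
  by-head-coefficient {y} true  y∈span = inj₂ (subst (_∈ span (u ∘ suc)) (sym u₀⊕[u₀⊕y]≡y) y∈span)
    where
    u₀⊕[u₀⊕y]≡y : u zero ⊕ ((true · u zero) ⊕ y) ≡ y
    u₀⊕[u₀⊕y]≡y = trans (cong (λ z → u zero ⊕ (z ⊕ y)) (true-· (u zero))) (x⊕[x⊕y]≡y (u zero) y)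

∉span-[] : (u : Fin 0 → V n) {x : V n} → x ≢ 𝟎 → x ∉ span u
∉span-[] _ x≢𝟎 (here x≡𝟎) = x≢𝟎 x≡𝟎

∉span-∷ : {u : Fin (suc m) → V n} {x : V n} →
          x ∉ span (u ∘ suc) → u zero ⊕ x ∉ span (u ∘ suc) → x ∉ span u
∉span-∷ {u = u} x∉span u₀⊕x∉span x∈span = [ x∉span , u₀⊕x∉span ]′ (∈span-∷⁻ {u = u} x∈span)

linIndep-∷ : {u : Fin (suc m) → V n} → LinIndep (u ∘ suc) → u zero ∉ span (u ∘ suc) → LinIndep u
linIndep-∷ {u = u} indep u₀∉span c eq = λ { zero → c₀≡false ; (suc i) → indep (c ∘ suc) rest≡𝟎 i }
  where
  rest : V _
  rest = lincomb (c ∘ suc) (u ∘ suc)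

  head-coefficient : ∀ b → (b · u zero) ⊕ rest ≡ 𝟎 → b ≡ false
  head-coefficient false _        = refl
  head-coefficient true  u₀⊕rest≡𝟎 =
    ⊥-elim (u₀∉span (subst (_∈ span (u ∘ suc)) (sym u₀≡rest) (lincomb∈span (u ∘ suc) (c ∘ suc))))
    where
    u₀≡rest : u zero ≡ rest
    u₀≡rest = ⊕≡𝟎⇒≡ (trans (cong (_⊕ rest) (sym (true-· (u zero)))) u₀⊕rest≡𝟎)

  c₀≡false : c zero ≡ false
  c₀≡false = head-coefficient (c zero) eq

  rest≡𝟎 : rest ≡ 𝟎
  rest≡𝟎 = begin
    rest                      ≡⟨ false-·-⊕ (u zero) rest ⟨
    (false · u zero) ⊕ rest   ≡⟨ cong (λ b → (b · u zero) ⊕ rest) c₀≡false ⟨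
    (c zero · u zero) ⊕ rest  ≡⟨ eq ⟩
    𝟎                         ∎
    where open ≡-Reasoning

linIndep₃ : {x y z : V n} → IsNonzeroSet (x ∷ y ∷ z ∷ []) → z ≢ x ⊕ y → LinIndep (List.lookup (x ∷ y ∷ z ∷ []))
linIndep₃ {n} {x} {y} {z} ((x≢y ∷ x≢z ∷ []) ∷ (y≢z ∷ []) ∷ [] ∷ [] , x≢𝟎 ∷ y≢𝟎 ∷ z≢𝟎 ∷ []) z≢x⊕y =
  linIndep-∷ {u = ⟨x,y,z⟩} (linIndep-∷ {u = ⟨y,z⟩} (linIndep-∷ {u = ⟨z⟩} (λ _ _ ()) z∉⟨⟩) y∉⟨z⟩) x∉⟨y,z⟩
  where
  ⟨⟩ : Fin 0 → V n
  ⟨⟩ = List.lookup []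
  ⟨z⟩ : Fin 1 → V n
  ⟨z⟩ = List.lookup (z ∷ [])
  ⟨y,z⟩ : Fin 2 → V n
  ⟨y,z⟩ = List.lookup (y ∷ z ∷ [])
  ⟨x,y,z⟩ : Fin 3 → V n
  ⟨x,y,z⟩ = List.lookup (x ∷ y ∷ z ∷ [])

  z∉⟨⟩ : z ∉ span ⟨⟩
  z∉⟨⟩ = ∉span-[] ⟨⟩ z≢𝟎

  y∉⟨z⟩ : y ∉ span ⟨z⟩
  y∉⟨z⟩ = ∉span-∷ {u = ⟨z⟩} (∉span-[] ⟨⟩ y≢𝟎) (∉span-[] ⟨⟩ (⊕≢𝟎 (y≢z ∘ sym)))

  x∉⟨z⟩ : x ∉ span ⟨z⟩
  x∉⟨z⟩ = ∉span-∷ {u = ⟨z⟩} (∉span-[] ⟨⟩ x≢𝟎) (∉span-[] ⟨⟩ (⊕≢𝟎 (x≢z ∘ sym)))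

  y⊕x∉⟨z⟩ : y ⊕ x ∉ span ⟨z⟩
  y⊕x∉⟨z⟩ = ∉span-∷ {u = ⟨z⟩} (∉span-[] ⟨⟩ (⊕≢𝟎 (x≢y ∘ sym)))
                    (∉span-[] ⟨⟩ (⊕≢𝟎 λ z≡y⊕x → z≢x⊕y (trans z≡y⊕x (comm y x))))

  x∉⟨y,z⟩ : x ∉ span ⟨y,z⟩
  x∉⟨y,z⟩ = ∉span-∷ {u = ⟨y,z⟩} x∉⟨z⟩ y⊕x∉⟨z⟩

hasIndep₃ : {x y z : V n} {T : List (V n)} → (x ∷ y ∷ z ∷ []) ⊆ T → IsNonzeroSet T → z ≢ x ⊕ y →
            HasIndep 3 T
hasIndep₃ xyz⊆T nonzeroSet z≢x⊕y =
  List.lookup (_ ∷ _ ∷ _ ∷ []) , (λ i → Any-resp-⊆ xyz⊆T (∈-lookup i)) ,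
  linIndep₃ (IsNonzeroSet-resp-⊆ xyz⊆T nonzeroSet) z≢x⊕y

hasIndep₃-of-4 : {T : List (V n)} → IsNonzeroSet T → 4 ≤ length T → HasIndep 3 T
hasIndep₃-of-4 {T = a ∷ b ∷ c ∷ d ∷ _} nonzeroSet@(_ ∷ _ ∷ (c≢d ∷ _) ∷ _ , _) _ with c ≟ᵥ (a ⊕ b)
... | no  c≢a⊕b = hasIndep₃ (refl ∷ refl ∷ refl ∷ minimum _) nonzeroSet c≢a⊕b
... | yes c≡a⊕b = hasIndep₃ (refl ∷ refl ∷ c ∷ʳ refl ∷ minimum _) nonzeroSet
                            λ d≡a⊕b → c≢d (trans c≡a⊕b (sym d≡a⊕b))
hasIndep₃-of-4 {T = []}             _ ()
hasIndep₃-of-4 {T = _ ∷ []}         _ (s≤s ())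
hasIndep₃-of-4 {T = _ ∷ _ ∷ []}     _ (s≤s (s≤s ()))
hasIndep₃-of-4 {T = _ ∷ _ ∷ _ ∷ []} _ (s≤s (s≤s (s≤s ())))

hasIndep₃-headTrue : {T : List (V (suc n))} → All (λ v → Vec.head v ≡ true) T → IsNonzeroSet T →
                     length T ≡ 3 → HasIndep 3 T
hasIndep₃-headTrue {T = (_ ∷ _) ∷ (_ ∷ _) ∷ (_ ∷ _) ∷ []} (refl ∷ refl ∷ refl ∷ []) nonzeroSet refl =
  hasIndep₃ ⊆-refl nonzeroSet λ ()

-- Upper bounds

KLIndependent-≤-length : {S T : List (V n)} → KLIndependent k ℓ S → T ⊆ S → k ≤ length T → HasIndep ℓ T
KLIndependent-≤-length {k = k} {T = T} indep T⊆S k≤|T|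
  with v , v∈take , v-indep ← indep (List.take k T) (⊆-trans (take-⊆ k T) T⊆S)
                                    (trans (List.length-take k T) (ℕ.m≤n⇒m⊓n≡m k≤|T|)) =
  v , (λ i → Any-resp-⊆ (take-⊆ k T) (v∈take i)) , v-indep

KLIndependent⇒few-in-span : {S : List (V n)} → KLIndependent k ℓ S → m < ℓ → (u : Fin m → V n) →
                            length (List.filter (_∈? span u) S) < k
KLIndependent⇒few-in-span {S = S} indep m<ℓ u = ℕ.≰⇒> λ k≤|S∩span| →
  let v , v∈S∩span , v-indep = KLIndependent-≤-length indep (filter-⊆ (_∈? span u) S) k≤|S∩span|
  in ℕ.<⇒≱ m<ℓ (linIndep-in-span⇒≤ (λ i → All.lookup (All.all-filter (_∈? span u) S) (v∈S∩span i)) v-indep)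

line-unique : {x y : V n} → x ≢ 𝟎 → y ≢ 𝟎 → x ⊕ y ≢ 𝟎 → Unique (x ∷ y ∷ x ⊕ y ∷ [])
line-unique {x = x} {y} x≢𝟎 y≢𝟎 x⊕y≢𝟎 = (x≢y ∷ x≢x⊕y ∷ []) ∷ (y≢x⊕y ∷ []) ∷ [] ∷ []
  where
  x≢y : x ≢ y
  x≢y refl = x⊕y≢𝟎 (⊕-self x)

  x≢x⊕y : x ≢ x ⊕ y
  x≢x⊕y = y≢𝟎 ∘ x≡x⊕y⇒y≡𝟎

  y≢x⊕y : y ≢ x ⊕ y
  y≢x⊕y eq = x≢𝟎 (x≡x⊕y⇒y≡𝟎 (trans eq (comm x y)))

KLIndependent₃⇒⊕∉ : {S : List (V n)} {a t : V n} → IsNonzeroSet S → KLIndependent 3 3 S →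
                    a ∈ S → t ∈ S → a ⊕ t ∉ S
KLIndependent₃⇒⊕∉ {S = S} {a} {t} (_ , nonzero) indep a∈S t∈S a⊕t∈S =
  ℕ.<⇒≱ (KLIndependent⇒few-in-span indep (ℕ.n<1+n 2) ⟨a,t⟩) 3≤|S∩span|
  where
  ⟨a,t⟩ : Fin 2 → V _
  ⟨a,t⟩ = List.lookup (a ∷ t ∷ [])

  line⊆S∩span : (a ∷ t ∷ a ⊕ t ∷ []) Subset.⊆ List.filter (_∈? span ⟨a,t⟩) S
  line⊆S∩span (here refl)                 = ∈-filter⁺ (_∈? span ⟨a,t⟩) a∈S (generator∈span ⟨a,t⟩ zero)
  line⊆S∩span (there (here refl))         = ∈-filter⁺ (_∈? span ⟨a,t⟩) t∈S (generator∈span ⟨a,t⟩ (suc zero))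
  line⊆S∩span (there (there (here refl))) = ∈-filter⁺ (_∈? span ⟨a,t⟩) a⊕t∈S
    (∈span-⊕ {u = ⟨a,t⟩} (generator∈span ⟨a,t⟩ zero) (generator∈span ⟨a,t⟩ (suc zero)))

  3≤|S∩span| : 3 ≤ length (List.filter (_∈? span ⟨a,t⟩) S)
  3≤|S∩span| = Unique⇒length≤ (line-unique (All.lookup nonzero a∈S) (All.lookup nonzero t∈S) (All.lookup nonzero a⊕t∈S))
                              line⊆S∩span

-- S and its translate a ⊕ S are disjoint.
KLIndependent₃⇒length≤ : {S : List (V (suc n))} → IsNonzeroSet S → KLIndependent 3 3 S → length S ≤ 2 ^ n
KLIndependent₃⇒length≤ {S = []} _ _ = z≤n
KLIndependent₃⇒length≤ {n} {S = a ∷ S′} nonzeroSet@(uniq , _) indep = ℕ.*-cancelˡ-≤ 2 (begin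
  2 * length S                           ≡⟨ cong (length S +_) (ℕ.+-identityʳ (length S)) ⟩
  length S + length S                    ≡⟨ cong (length S +_) (List.length-map (a ⊕_) S) ⟨
  length S + length (List.map (a ⊕_) S)  ≡⟨ List.length-++ S ⟨
  length (S ++ List.map (a ⊕_) S)        ≤⟨ Unique⇒length≤ S∪a⊕S-unique (λ _ → ∈-allVec _) ⟩
  length (allVec (suc n))                ≡⟨ length-allVec (suc n) ⟩
  2 ^ suc n                              ∎)
  where
  open ℕ.≤-Reasoning

  S : List (V (suc n))
  S = a ∷ S′

  S∪a⊕S-unique : Unique (S ++ List.map (a ⊕_) S)
  S∪a⊕S-unique = Unique.++⁺ uniq (Unique.map⁺ (⊕-cancelˡ a) uniq) λ (x∈S , x∈a⊕S) →
    let t , t∈S , x≡a⊕t = ∈-map⁻ (a ⊕_) x∈a⊕S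
    in KLIndependent₃⇒⊕∉ nonzeroSet indep (here refl) t∈S (subst (_∈ S) x≡a⊕t x∈S)

IsNonzeroSet⇒length≤ : {S : List (V n)} → IsNonzeroSet S → length S ≤ 2 ^ n ∸ 1
IsNonzeroSet⇒length≤ {n} {S} (uniq , nonzero) =
  ℕ.∸-monoˡ-≤ 1 (subst (length (𝟎 ∷ S) ≤_) (length-allVec n) (Unique⇒length≤ 𝟎∷S-unique (λ _ → ∈-allVec _)))
  where
  𝟎∷S-unique : Unique (𝟎 ∷ S)
  𝟎∷S-unique = All.map (λ x≢𝟎 → x≢𝟎 ∘ sym) nonzero ∷ uniq

-- Extremal sets

headTrueVec : ∀ n → List (V (suc n))
headTrueVec n = List.map (true ∷_) (allVec n)

headTrueVec-isNonzeroSet : ∀ n → IsNonzeroSet (headTrueVec n)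
headTrueVec-isNonzeroSet n =
  Unique.map⁺ Vec.∷-injectiveʳ (allVec-unique n) , All.map⁺ (All.universal (λ _ ()) (allVec n))

length-headTrueVec : ∀ n → length (headTrueVec n) ≡ 2 ^ n
length-headTrueVec n = trans (List.length-map (true ∷_) (allVec n)) (length-allVec n)

headTrueVec-KLIndependent : ∀ n → KLIndependent 3 3 (headTrueVec n)
headTrueVec-KLIndependent n T T⊆H =
  hasIndep₃-headTrue (All-resp-⊆ T⊆H (All.map⁺ (All.universal (λ _ → refl) (allVec n))))
                     (IsNonzeroSet-resp-⊆ T⊆H (headTrueVec-isNonzeroSet n))

nonzeroVec : ∀ n → List (V n)
nonzeroVec n = List.filter (λ x → ¬? (x ≟ᵥ 𝟎)) (allVec n)

nonzeroVec-isNonzeroSet : ∀ n → IsNonzeroSet (nonzeroVec n)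
nonzeroVec-isNonzeroSet n = Unique.filter⁺ _ (allVec-unique n) , All.all-filter _ (allVec n)

length-nonzeroVec : ∀ n → length (nonzeroVec n) ≡ 2 ^ n ∸ 1
length-nonzeroVec n =
  ℕ.≤-antisym (IsNonzeroSet⇒length≤ (nonzeroVec-isNonzeroSet n)) (ℕ.∸-monoˡ-≤ 1 2^n≤|𝟎∷nonzeroVec|)
  where
  allVec⊆𝟎∷nonzeroVec : allVec n Subset.⊆ (𝟎 ∷ nonzeroVec n)
  allVec⊆𝟎∷nonzeroVec {x} _ with x ≟ᵥ 𝟎
  ... | yes x≡𝟎 = here x≡𝟎
  ... | no  x≢𝟎 = there (∈-filter⁺ _ (∈-allVec x) x≢𝟎)

  2^n≤|𝟎∷nonzeroVec| : 2 ^ n ≤ length (𝟎 ∷ nonzeroVec n)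
  2^n≤|𝟎∷nonzeroVec| =
    subst (_≤ length (𝟎 ∷ nonzeroVec n)) (length-allVec n) (Unique⇒length≤ (allVec-unique n) allVec⊆𝟎∷nonzeroVec)

nonzeroVec-KLIndependent : ∀ n → 4 ≤ k → KLIndependent k 3 (nonzeroVec n)
nonzeroVec-KLIndependent n 4≤k T T⊆nonzeroVec |T|≡k =
  hasIndep₃-of-4 (IsNonzeroSet-resp-⊆ T⊆nonzeroVec (nonzeroVec-isNonzeroSet n)) (subst (4 ≤_) (sym |T|≡k) 4≤k)

IndEq-k≡3 : ∀ n → IndEq (suc n) 3 3 (2 ^ n)
IndEq-k≡3 n =
  (headTrueVec n , headTrueVec-isNonzeroSet n , headTrueVec-KLIndependent n , length-headTrueVec n) ,
  λ _ → KLIndependent₃⇒length≤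

IndEq-4≤k : ∀ n → 4 ≤ k → IndEq n k 3 (2 ^ n ∸ 1)
IndEq-4≤k n 4≤k =
  (nonzeroVec n , nonzeroVec-isNonzeroSet n , nonzeroVec-KLIndependent n 4≤k , length-nonzeroVec n) ,
  λ _ nonzeroSet _ → IsNonzeroSet⇒length≤ nonzeroSet

corollary2p4 : ∀ (n k : ℕ) → 3 ≤ n → 3 ≤ k → k ≤ 2 ^ n ∸ 1 →
    (k ≡ 3 → IndEq n k 3 (2 ^ (n ∸ 1))) × (4 ≤ k → IndEq n k 3 (2 ^ n ∸ 1))
corollary2p4 (suc n) k _ _ _ = (λ { refl → IndEq-k≡3 n }) , IndEq-4≤k (suc n)
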